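{- For $n\ge1$, consider the poset $(\{A : A\vdash[n]\},\le_\ast)$. It is ranked with rank function $A\mapsto n-\ell(A)$, and it is Eulerian in the sense that for every $B\le_\ast C$ the Möbius function satisfies $\mu(B,C)=(-1)^{\ell(B)-\ell(C)}$. Moreover, for any fixed set partition $A\vdash[n]$, the subposet $\{B : B\le_\ast A\}$ with the order $\le_\ast$ is isomorphic to a boolean lattice.
   Context: A set partition $A\vdash[n]$ is a set of nonempty pairwise disjoint subsets (parts) of $[n]=\{1,\dots,n\}$ with union $[n]$; $\ell(A)$ is its number of parts. Define a covering relation: $B$ covers $A$ if there are two parts $A_i,A_{i'}$ of $A$ such that every element of $A_i$ is less than every element of $A_{i'}$, and $B=(A\setminus\{A_i,A_{i'}\})\cup\{A_i\cup A_{i'}\}$. The order $\le_\ast$ is the reflexive–transitive closure of this covering relation. -}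

module Defs where

open import Data.Bool using (Bool)
import Data.Bool.Properties as BoolP
open import Data.Nat using (ℕ; zero; suc; _∸_)
open import Data.Integer using (ℤ; _+_; -_; _^_) renaming (1ℤ to +1; 0ℤ to +0)
open import Data.Fin using (Fin; _<_)
open import Data.Fin.Properties using (all?)
open import Data.Fin.Subset using (Subset; _∈_; _∪_; _⊆_)
open import Data.Fin.Subset.Properties using (_∈?_)
open import Data.Vec using (Vec; lookup; toList)
open import Data.Vec.Properties using (≡-dec)
open import Data.List using (List; length; deduplicate; map; foldr)
open import Data.List.Membership.Propositional renaming (_∈_ to _∈ₗ_)
open import Data.List.Relation.Unary.Unique.Propositional using (Unique)
open import Data.Product using (Σ; ∃; ∃-syntax; _×_; _,_; proj₁)
open import Data.Sum using (_⊎_)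
open import Relation.Nullary using (¬_; Dec; yes; no)
open import Relation.Nullary.Decidable using (True)
open import Relation.Binary.PropositionalEquality using (_≡_; _≢_)
open import Relation.Binary.Construct.Closure.ReflexiveTransitive using (Star)
open import Function.Bundles using (_⇔_)

-- A set partition A ⊢ [n] is encoded by the map  i ↦ (the part of A
-- containing i),  stored as a vector of subsets.  A vector r of subsets
-- arises this way iff  i ∈ r[i]  and  j ∈ r[i] ⇒ r[j] = r[i];
-- the parts of A are then exactly the subsets r[i].  This encoding is a
-- bijection between set partitions and such vectors, so propositional
-- equality (≡) of encodings is equality of set partitions.

_≟ˢ_ : ∀ {n} (p q : Subset n) → Dec (p ≡ q)
_≟ˢ_ = ≡-dec BoolP._≟_

ValidBlocks : ∀ {n} → Vec (Subset n) n → Set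
ValidBlocks {n} r =
  (∀ (i : Fin n) → i ∈ lookup r i) ×
  (∀ (i j : Fin n) → j ∈ lookup r i → lookup r j ≡ lookup r i)

validBlocks? : ∀ {n} (r : Vec (Subset n) n) → Dec (ValidBlocks r)
validBlocks? r with all? (λ i → i ∈? lookup r i)
                  | all? (λ i → all? (λ j → dec i j))
  where
  dec : ∀ i j → Dec (j ∈ lookup r i → lookup r j ≡ lookup r i)
  dec i j with j ∈? lookup r i | lookup r j ≟ˢ lookup r i
  ... | _     | yes e = yes (λ _ → e)
  ... | no  m | no _  = yes (λ x → Data.Empty.⊥-elim (m x))
    where import Data.Empty
  ... | yes m | no e  = no (λ f → e (f m))
... | yes a | yes b = yes (a , b)
... | no a  | _     = no (λ v → a (proj₁ v))
... | yes _ | no b  = no (λ v → b (Data.Product.proj₂ v))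
  where import Data.Product

-- The type of set partitions of [n].  (True is a proof-irrelevant unit,
-- so two partitions are equal iff their block vectors are equal.)
SetPartition : ℕ → Set
SetPartition n = Σ (Vec (Subset n) n) (λ r → True (validBlocks? r))

_∈parts_ : ∀ {n} → Subset n → SetPartition n → Set
S ∈parts (r , _) = ∃[ i ] lookup r i ≡ S

ℓ : ∀ {n} → SetPartition n → ℕ
ℓ (r , _) = length (deduplicate _≟ˢ_ (toList r))

Covers : ∀ {n} → SetPartition n → SetPartition n → Set
Covers {n} A B =
  ∃[ P ] ∃[ Q ] (P ∈parts A × Q ∈parts A ×
    (∀ (x y : Fin n) → x ∈ P → y ∈ Q → x < y) ×
    (∀ S → S ∈parts B ⇔ ((S ∈parts A × S ≢ P × S ≢ Q) ⊎ S ≡ P ∪ Q)))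

_≤*_ : ∀ {n} → SetPartition n → SetPartition n → Set
_≤*_ = Star Covers

module PosetNotions {X : Set} (_≤_ : X → X → Set) where

  _⋖_ : X → X → Set
  x ⋖ y = x ≤ y × x ≢ y × (∀ z → x ≤ z → z ≤ y → z ≡ x ⊎ z ≡ y)

  IsRankFunction : (X → ℕ) → Set
  IsRankFunction ρ =
    (∀ x → (∀ y → y ≤ x → y ≡ x) → ρ x ≡ 0) ×
    (∀ x y → x ⋖ y → ρ y ≡ suc (ρ x))

  sumℤ : List ℤ → ℤ
  sumℤ = foldr _+_ +0

  IsMoebius : (X → X → ℤ) → Set
  IsMoebius μ =
    (∀ x → μ x x ≡ +1) ×
    (∀ x y → x ≤ y → x ≢ y → (zs : List X) → Unique zs →
       (∀ z → z ∈ₗ zs ⇔ (x ≤ z × z ≤ y)) →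
       sumℤ (map (μ x) zs) ≡ +0)

  DownSet : X → Set
  DownSet x = Σ X (λ y → y ≤ x)

  DownIsBoolean : X → Set
  DownIsBoolean x =
    ∃[ k ] Σ (DownSet x → Subset k) λ f → Σ (Subset k → DownSet x) λ g →
      (∀ y → proj₁ (g (f y)) ≡ proj₁ y) ×
      (∀ s → f (g s) ≡ s) ×
      (∀ y z → (proj₁ y ≤ proj₁ z) ⇔ (f y ⊆ f z))

rk : ∀ {n} → SetPartition n → ℕ
rk {n} A = n ∸ ℓ A

signℓ : ∀ {n} → SetPartition n → SetPartition n → ℤ
signℓ B C = (- +1) ^ (ℓ B ∸ ℓ C)

-- Call m non-minimal in A if a smaller element lies in the block of m. A partition B lies
-- below A exactly when it arises from A by cutting the blocks of A immediately before some of
-- their non-minimal elements, and B is then recovered from its own set of non-minimal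
-- elements, which is a subset of that of A. Moreover B ≤* C iff the non-minimal elements of B
-- are among those of C. Hence the down-set of A is the boolean lattice of subsets of the
-- non-minimal elements of A. Since ℓ(A) = n − #(non-minimal elements of A), the rank is the
-- number of non-minimal elements, and on every interval, a boolean lattice, the Möbius
-- function is (−1) to the rank difference.

module Submission where

open import Defs
open import Data.Nat using (ℕ; _≥_)
open import Data.Integer using (ℤ)
open import Data.Product using (_×_)
open import Relation.Binary.PropositionalEquality using (_≡_)

open import Data.Bool using (not)
open import Data.Bool.Properties using (T-irrelevant)
open import Data.Empty using (⊥-elim)
open import Data.Fin as F using (Fin; toℕ; _<_; _≤_)
open import Data.Fin.Induction using (<-wellFounded)
open import Data.Fin.Properties using (any?; all?; toℕ-injective; <-cmp)
open import Data.Fin.Subset as S using (Subset; inside; outside; _∈_; _∉_; _⊆_; _⊂_; _∪_; _∩_; ⁅_⁆; ∁; ∣_∣)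
open import Data.Fin.Subset.Induction using (⊂-wellFounded)
open import Data.Fin.Subset.Properties
  using ( _∈?_; ⊆-antisym; ⊆⊤; drop-∷-⊆; out⊆; s⊆s; ∈⊤; x∈⁅x⁆; x∈⁅y⁆⇒x≡y; x∈p∪q⁺; x∈p∪q⁻; x∈p∩q⁺; x∈p∩q⁻
        ; ∪-identityʳ; ∩-zeroˡ; ∣⊥∣≡0; ∣p∣≤n; ∣∁p∣≡n∸∣p∣; p⊆q⇒∣p∣≤∣q∣)
open import Data.Integer using (0ℤ; 1ℤ; _+_; -_; _^_)
import Data.Integer.Properties as ZP
open import Algebra.Properties.AbelianGroup ZP.+-0-abelianGroup using (∙-cancelˡ; ∙-cancelʳ)
open import Data.List as L using (List; []; _∷_; map; filter; length; deduplicate)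
import Data.List.Properties as LP
open import Data.List.Membership.Propositional using () renaming (_∈_ to _∈ₗ_)
open import Data.List.Membership.Propositional.Properties
  using (∈-allFin; ∈-map⁺; ∈-map⁻; ∈-filter⁺; ∈-filter⁻; ∈-++⁺ˡ; ∈-++⁺ʳ; ∈-++⁻; deduplicate-∈⇔)
open import Data.List.Membership.Propositional.Properties.WithK using (unique∧set⇒bag)
open import Data.List.Relation.Binary.BagAndSetEquality using (∼bag⇒↭)
open import Data.List.Relation.Binary.Permutation.Propositional.Properties using (↭-length)
import Data.List.Relation.Unary.All as All
open import Data.List.Relation.Unary.AllPairs using ([]; _∷_)
open import Data.List.Relation.Unary.Any using (here; there)
open import Data.List.Relation.Unary.Unique.Propositional using (Unique)
import Data.List.Relation.Unary.Unique.Propositional.Properties as Unique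
import Data.List.Relation.Unary.Unique.DecPropositional.Properties as DecUnique
open import Data.Nat as ℕ using (zero; suc; _∸_)
import Data.Nat.Properties as ℕ
open import Data.Product using (∃-syntax; _,_; proj₁; proj₂; swap)
open import Data.Sum using (_⊎_; inj₁; inj₂; [_,_])
open import Data.Vec as V using (Vec; lookup; tabulate; toList)
import Data.Vec.Properties as VP
import Data.Vec.Membership.Propositional.Properties as VecMembership
import Data.Vec.Relation.Unary.Any as VecAny
open import Data.Vec.Relation.Unary.Any.Properties using (lookup-index)
open import Function.Base using (_∘_)
open import Function.Bundles using (_⇔_; mk⇔; Equivalence)
open import Induction.WellFounded using (Acc; acc)
open import Relation.Binary.Construct.Closure.ReflexiveTransitive using (ε; _◅_; _◅◅_)
import Relation.Binary.Construct.On as On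
open import Relation.Binary.Definitions using (tri<; tri≈; tri>)
open import Relation.Binary.PropositionalEquality
  using (_≢_; refl; sym; trans; cong; cong₂; subst; subst₂; module ≡-Reasoning)
open import Relation.Nullary using (¬_; Dec; yes; no; does)
open import Relation.Nullary.Decidable using (toWitness; fromWitness; _×-dec_; _⊎-dec_; _→-dec_; ¬?)
open import Relation.Unary using (Decidable)

open Equivalence using (to; from)

private
  variable
    n : ℕ

subsetOf : {P : Fin n → Set} → Decidable P → Subset n
subsetOf P? = tabulate (λ i → does (P? i))

∈-subsetOf : {P : Fin n → Set} (P? : Decidable P) {x : Fin n} → x ∈ subsetOf P? ⇔ P x
∈-subsetOf {P = P} P? {x} = mk⇔ fw bw
  where
  lookup≡ : lookup (subsetOf P?) x ≡ does (P? x)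
  lookup≡ = VP.lookup∘tabulate _ x
  fw : x ∈ subsetOf P? → P x
  fw x∈ with P? x | trans (sym (VP.[]=⇒lookup x∈)) lookup≡
  ... | yes p | _ = p
  bw : P x → x ∈ subsetOf P?
  bw p with P? x in eq
  ... | yes _ = VP.lookup⇒[]= x _ (trans lookup≡ (cong does eq))
  ... | no ¬p = ⊥-elim (¬p p)

lookup-ext : {A : Set} {r s : Vec A n} → (∀ i → lookup r i ≡ lookup s i) → r ≡ s
lookup-ext {r = r} {s} eq =
  trans (sym (VP.tabulate∘lookup r)) (trans (VP.tabulate-cong eq) (VP.tabulate∘lookup s))

block : SetPartition n → Fin n → Subset n
block A = lookup (proj₁ A)

block-refl : (A : SetPartition n) (i : Fin n) → i ∈ block A i
block-refl (_ , valid) = proj₁ (toWitness valid)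

block-≡ : (A : SetPartition n) {i j : Fin n} → j ∈ block A i → block A j ≡ block A i
block-≡ (_ , valid) {i} {j} = proj₂ (toWitness valid) i j

block-sym : (A : SetPartition n) {i j : Fin n} → j ∈ block A i → i ∈ block A j
block-sym A {i} j∈ = subst (i ∈_) (sym (block-≡ A j∈)) (block-refl A i)

block-trans : (A : SetPartition n) {i j k : Fin n} → j ∈ block A i → k ∈ block A j → k ∈ block A i
block-trans A j∈ = subst (_ ∈_) (block-≡ A j∈)

partition-ext : {A B : SetPartition n} →
  (∀ {i j} → j ∈ block A i → j ∈ block B i) → (∀ {i j} → j ∈ block B i → j ∈ block A i) → A ≡ B
partition-ext {A = r , p} {B = s , q} A⊆B B⊆A
  with lookup-ext {r = r} {s} (λ i → ⊆-antisym (A⊆B {i}) (B⊆A {i}))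
... | refl = cong (r ,_) (T-irrelevant p q)

-- Cutting blocks

Between : Fin n → Fin n → Fin n → Set
Between i j m = (i < m × m ≤ j) ⊎ (j < m × m ≤ i)

between? : (i j m : Fin n) → Dec (Between i j m)
between? i j m = ((i F.<? m) ×-dec (m F.≤? j)) ⊎-dec ((j F.<? m) ×-dec (m F.≤? i))

Between-sym : {i j m : Fin n} → Between i j m → Between j i m
Between-sym (inj₁ b) = inj₂ b
Between-sym (inj₂ b) = inj₁ b

Between-irrefl : {i m : Fin n} → ¬ Between i i m
Between-irrefl (inj₁ (i<m , m≤i)) = ℕ.<⇒≱ i<m m≤i
Between-irrefl (inj₂ (i<m , m≤i)) = ℕ.<⇒≱ i<m m≤i

Between-split : {i k m : Fin n} (j : Fin n) → Between i k m → Between i j m ⊎ Between j k m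
Between-split {m = m} j (inj₁ (i<m , m≤k)) with m F.≤? j
... | yes m≤j = inj₁ (inj₁ (i<m , m≤j))
... | no  m≰j = inj₂ (inj₁ (ℕ.≰⇒> m≰j , m≤k))
Between-split {m = m} j (inj₂ (k<m , m≤i)) with m F.≤? j
... | yes m≤j = inj₂ (inj₂ (k<m , m≤j))
... | no  m≰j = inj₁ (inj₂ (ℕ.≰⇒> m≰j , m≤i))

-- i and j stay together when A's block is cut immediately before each of its elements outside T.
SameCut : SetPartition n → Subset n → Fin n → Fin n → Set
SameCut A T i j = j ∈ block A i × (∀ m → m ∈ block A i → Between i j m → m ∈ T)

sameCut? : (A : SetPartition n) (T : Subset n) (i j : Fin n) → Dec (SameCut A T i j)
sameCut? A T i j =
  (j ∈? block A i) ×-dec all? (λ m → (m ∈? block A i) →-dec (between? i j m →-dec (m ∈? T)))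

module _ (A : SetPartition n) (T : Subset n) where

  SameCut-refl : ∀ i → SameCut A T i i
  SameCut-refl i = block-refl A i , λ _ _ b → ⊥-elim (Between-irrefl b)

  SameCut-sym : ∀ {i j} → SameCut A T i j → SameCut A T j i
  SameCut-sym (j∈ , closed) =
    block-sym A j∈ , λ m m∈ b → closed m (subst (m ∈_) (block-≡ A j∈) m∈) (Between-sym b)

  SameCut-trans : ∀ {i j k} → SameCut A T i j → SameCut A T j k → SameCut A T i k
  SameCut-trans {i} {j} {k} (j∈ , closedᵢⱼ) (k∈ , closedⱼₖ) = block-trans A j∈ k∈ , closed
    where
    closed : ∀ m → m ∈ block A i → Between i k m → m ∈ T
    closed m m∈ b with Between-split j b
    ... | inj₁ bᵢⱼ = closedᵢⱼ m m∈ bᵢⱼ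
    ... | inj₂ bⱼₖ = closedⱼₖ m (subst (m ∈_) (sym (block-≡ A j∈)) m∈) bⱼₖ

  private
    blocks : Vec (Subset n) n
    blocks = tabulate (λ i → subsetOf (sameCut? A T i))

    ∈-blocks : ∀ {i j} → j ∈ lookup blocks i ⇔ SameCut A T i j
    ∈-blocks {i} {j} =
      subst (λ p → j ∈ p ⇔ SameCut A T i j) (sym (VP.lookup∘tabulate _ i)) (∈-subsetOf (sameCut? A T i))

    valid : ValidBlocks blocks
    valid = (λ i → from ∈-blocks (SameCut-refl i))
          , (λ i j j∈ → ⊆-antisym
               (λ k∈ → from ∈-blocks (SameCut-trans (to ∈-blocks j∈) (to ∈-blocks k∈)))
               (λ k∈ → from ∈-blocks (SameCut-trans (SameCut-sym (to ∈-blocks j∈)) (to ∈-blocks k∈))))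

  opaque
    cut : SetPartition n
    cut = blocks , fromWitness valid

    ∈-cut : ∀ {i j} → j ∈ block cut i ⇔ SameCut A T i j
    ∈-cut = ∈-blocks

NonMinimal : SetPartition n → Fin n → Set
NonMinimal A m = ∃[ j ] (j < m × j ∈ block A m)

nonMinimal? : (A : SetPartition n) → Decidable (NonMinimal A)
nonMinimal? A m = any? (λ j → (j F.<? m) ×-dec (j ∈? block A m))

nonMinimals : SetPartition n → Subset n
nonMinimals A = subsetOf (nonMinimal? A)

∈-nonMinimals : (A : SetPartition n) {m : Fin n} → m ∈ nonMinimals A ⇔ NonMinimal A m
∈-nonMinimals A = ∈-subsetOf (nonMinimal? A)

Between⇒NonMinimal : (A : SetPartition n) {i j m : Fin n} →
  j ∈ block A i → m ∈ block A i → Between i j m → NonMinimal A m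
Between⇒NonMinimal A j∈ m∈ (inj₁ (i<m , _)) = _ , i<m , block-sym A m∈
Between⇒NonMinimal A j∈ m∈ (inj₂ (j<m , _)) = _ , j<m , block-trans A (block-sym A m∈) j∈

greatestBelow : {P : Fin n → Set} (P? : Decidable P) → (b : ℕ) → ∃[ j ] (P j × toℕ j ℕ.< b) →
  ∃[ p ] (P p × toℕ p ℕ.< b × (∀ q → P q → toℕ q ℕ.< b → q ≤ p))
greatestBelow _ zero (_ , _ , ())
greatestBelow {P = P} P? (suc b) (j , Pj , j<1+b) with any? (λ q → P? q ×-dec (toℕ q ℕ.≟ b))
... | yes (q , Pq , q≡b) =
  q , Pq , ℕ.≤-reflexive (cong suc q≡b) , λ q′ _ q′<1+b → subst (toℕ q′ ℕ.≤_) (sym q≡b) (ℕ.≤-pred q′<1+b)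
... | no nothing-at-b =
  let (p , Pp , p<b , greatest) = greatestBelow P? b (j , Pj , below Pj j<1+b)
  in  p , Pp , ℕ.m≤n⇒m≤1+n p<b , λ q Pq q<1+b → greatest q Pq (below Pq q<1+b)
  where
  below : ∀ {q} → P q → toℕ q ℕ.< suc b → toℕ q ℕ.< b
  below {q} Pq q<1+b with ℕ.m≤n⇒m<n∨m≡n (ℕ.≤-pred q<1+b)
  ... | inj₁ q<b = q<b
  ... | inj₂ q≡b = ⊥-elim (nothing-at-b (q , Pq , q≡b))

predecessor : (A : SetPartition n) (m : Fin n) → NonMinimal A m →
  ∃[ p ] (p < m × p ∈ block A m × (∀ q → q ∈ block A m → q < m → q ≤ p))
predecessor A m (j , j<m , j∈) with greatestBelow (_∈? block A m) (toℕ m) (j , j∈ , j<m)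
... | p , p∈ , p<m , greatest = p , p<m , p∈ , λ q q∈ q<m → greatest q q∈ q<m

minimalInBlock : (A : SetPartition n) (i : Fin n) → ∃[ j ] (j ∈ block A i × ¬ NonMinimal A j)
minimalInBlock A i = go i (<-wellFounded i) (block-refl A i)
  where
  go : ∀ j → Acc _<_ j → j ∈ block A i → ∃[ j ] (j ∈ block A i × ¬ NonMinimal A j)
  go j (acc smaller) j∈ with nonMinimal? A j
  ... | no  minimal          = j , j∈ , minimal
  ... | yes (k , k<j , k∈) = go k (smaller k<j) (block-trans A j∈ k∈)

-- The partitions below A are the cuts of A

record IntervalRefinement (B A : SetPartition n) : Set where
  field
    refines : ∀ {i j} → j ∈ block B i → j ∈ block A i
    convex  : ∀ {i j m} → j ∈ block B i → m ∈ block A i → Between i j m → m ∈ block B i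

IntervalRefinement-refl : (A : SetPartition n) → IntervalRefinement A A
IntervalRefinement-refl A = record { refines = λ j∈ → j∈ ; convex = λ _ m∈ _ → m∈ }

IntervalRefinement-trans : {A B C : SetPartition n} →
  IntervalRefinement A B → IntervalRefinement B C → IntervalRefinement A C
IntervalRefinement-trans A⊑B B⊑C = record
  { refines = λ j∈ → B⊑C.refines (A⊑B.refines j∈)
  ; convex  = λ j∈ m∈ b → A⊑B.convex j∈ (B⊑C.convex (A⊑B.refines j∈) m∈ b) b
  }
  where
  module A⊑B = IntervalRefinement A⊑B
  module B⊑C = IntervalRefinement B⊑C

Covers⇒IntervalRefinement : {A B : SetPartition n} → Covers A B → IntervalRefinement A B
Covers⇒IntervalRefinement {A = A} {B} (P , Q , (p , [p]≡P) , (q , [q]≡Q) , P<Q , parts) =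
  record { refines = refines ; convex = convex }
  where
  merged-or-kept : ∀ i → block B i ≡ block A i ⊎ block B i ≡ P ∪ Q
  merged-or-kept i with to (parts (block B i)) (i , refl)
  ... | inj₁ ((k , [k]≡) , _) =
    inj₁ (trans (sym [k]≡) (sym (block-≡ A (subst (i ∈_) (sym [k]≡) (block-refl B i)))))
  ... | inj₂ [i]≡P∪Q = inj₂ [i]≡P∪Q
  in-P∪Q : ∀ {i} → block B i ≡ P ∪ Q → i ∈ P ⊎ i ∈ Q
  in-P∪Q {i} [i]≡ = x∈p∪q⁻ P Q (subst (i ∈_) [i]≡ (block-refl B i))
  block-P : ∀ {i} → i ∈ P → block A i ≡ P
  block-P i∈P = trans (block-≡ A (subst (_ ∈_) (sym [p]≡P) i∈P)) [p]≡P
  block-Q : ∀ {i} → i ∈ Q → block A i ≡ Q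
  block-Q i∈Q = trans (block-≡ A (subst (_ ∈_) (sym [q]≡Q) i∈Q)) [q]≡Q
  refines : ∀ {i j} → j ∈ block A i → j ∈ block B i
  refines {i} {j} j∈ with merged-or-kept i
  ... | inj₁ [i]≡ = subst (j ∈_) (sym [i]≡) j∈
  ... | inj₂ [i]≡ with in-P∪Q [i]≡
  ...   | inj₁ i∈P = subst (j ∈_) (sym [i]≡) (x∈p∪q⁺ (inj₁ (subst (j ∈_) (block-P i∈P) j∈)))
  ...   | inj₂ i∈Q = subst (j ∈_) (sym [i]≡) (x∈p∪q⁺ (inj₂ (subst (j ∈_) (block-Q i∈Q) j∈)))
  -- Since P lies entirely below Q, no element of Q lies between two elements of P, and vice versa.
  convex : ∀ {i j m} → j ∈ block A i → m ∈ block B i → Between i j m → m ∈ block A i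
  convex {i} {j} {m} j∈ m∈ b with merged-or-kept i
  ... | inj₁ [i]≡ = subst (m ∈_) [i]≡ m∈
  ... | inj₂ [i]≡ with in-P∪Q [i]≡ | x∈p∪q⁻ P Q (subst (m ∈_) [i]≡ m∈)
  ...   | inj₁ i∈P | inj₁ m∈P = subst (m ∈_) (sym (block-P i∈P)) m∈P
  ...   | inj₂ i∈Q | inj₂ m∈Q = subst (m ∈_) (sym (block-Q i∈Q)) m∈Q
  ...   | inj₁ i∈P | inj₂ m∈Q with b
  ...     | inj₁ (_ , m≤j) = ⊥-elim (ℕ.<⇒≱ (P<Q j m (subst (j ∈_) (block-P i∈P) j∈) m∈Q) m≤j)
  ...     | inj₂ (_ , m≤i) = ⊥-elim (ℕ.<⇒≱ (P<Q i m i∈P m∈Q) m≤i)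
  convex {i} {j} {m} j∈ m∈ b | inj₂ [i]≡ | inj₂ i∈Q | inj₁ m∈P with b
  ...     | inj₁ (i<m , _) = ⊥-elim (ℕ.<-asym i<m (P<Q m i m∈P i∈Q))
  ...     | inj₂ (j<m , _) = ⊥-elim (ℕ.<-asym j<m (P<Q m j m∈P (subst (j ∈_) (block-Q i∈Q) j∈)))

≤*⇒IntervalRefinement : {A B : SetPartition n} → A ≤* B → IntervalRefinement A B
≤*⇒IntervalRefinement {A = A} ε = IntervalRefinement-refl A
≤*⇒IntervalRefinement (A⋖C ◅ C≤B) =
  IntervalRefinement-trans (Covers⇒IntervalRefinement A⋖C) (≤*⇒IntervalRefinement C≤B)

≤*⇒refines : {A B : SetPartition n} → A ≤* B → ∀ {i j} → j ∈ block A i → j ∈ block B i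
≤*⇒refines A≤B = IntervalRefinement.refines (≤*⇒IntervalRefinement A≤B)

IntervalRefinement⇒≡cut : {A B : SetPartition n} → IntervalRefinement B A → B ≡ cut A (nonMinimals B)
IntervalRefinement⇒≡cut {A = A} {B} B⊑A =
  partition-ext (λ j∈ → from (∈-cut A H) (sameCut j∈)) (λ j∈ → together (to (∈-cut A H) j∈))
  where
  open IntervalRefinement B⊑A
  H : Subset _
  H = nonMinimals B
  sameCut : ∀ {i j} → j ∈ block B i → SameCut A H i j
  sameCut j∈ = refines j∈ , λ m m∈ b → from (∈-nonMinimals B) (Between⇒NonMinimal B j∈ (convex j∈ m∈ b) b)
  -- j is non-minimal in B, and its B-predecessor either lies beyond i (then recurse) or
  -- puts i between itself and j (then use convexity).
  together< : ∀ {i} j → Acc _<_ j → i < j → SameCut A H i j → j ∈ block B i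
  together< {i} j (acc smaller) i<j (j∈ , closed)
    with to (∈-nonMinimals B) (closed j j∈ (inj₁ (i<j , ℕ.≤-refl)))
  ... | p , p<j , p∈ with <-cmp p i
  ...   | tri< p<i _ _ = block-trans B (block-sym B i∈[p]) (block-sym B p∈)
    where
    i∈[p] : i ∈ block B p
    i∈[p] = convex (block-sym B p∈) (block-sym A (block-trans A j∈ (refines p∈))) (inj₁ (p<i , ℕ.<⇒≤ i<j))
  ...   | tri≈ _ refl _ = block-sym B p∈
  ...   | tri> _ _ i<p = block-trans B p∈[i] (block-sym B p∈)
    where
    closed′ : ∀ m → m ∈ block A i → Between i p m → m ∈ H
    closed′ m m∈ (inj₁ (i<m , m≤p)) = closed m m∈ (inj₁ (i<m , ℕ.≤-trans m≤p (ℕ.<⇒≤ p<j)))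
    closed′ m m∈ (inj₂ (p<m , m≤i)) = ⊥-elim (ℕ.<-asym i<p (ℕ.<-≤-trans p<m m≤i))
    p∈[i] : p ∈ block B i
    p∈[i] = together< p (smaller p<j) i<p (block-trans A j∈ (refines p∈) , closed′)
  together : ∀ {i j} → SameCut A H i j → j ∈ block B i
  together {i} {j} s with <-cmp i j
  ... | tri< i<j _ _ = together< j (<-wellFounded j) i<j s
  ... | tri≈ _ refl _ = block-refl B i
  ... | tri> _ _ j<i = block-sym B (together< i (<-wellFounded i) j<i (SameCut-sym A H s))

≤*⇒≡cut : {A B : SetPartition n} → B ≤* A → B ≡ cut A (nonMinimals B)
≤*⇒≡cut B≤A = IntervalRefinement⇒≡cut (≤*⇒IntervalRefinement B≤A)

module _ (A : SetPartition n) (T : Subset n) where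

  NonMinimal-cut⁻ : ∀ {m} → NonMinimal (cut A T) m → NonMinimal A m × m ∈ T
  NonMinimal-cut⁻ {m} (p , p<m , p∈) with to (∈-cut A T) p∈
  ... | p∈A , closed = (p , p<m , p∈A) , closed m (block-refl A m) (inj₂ (p<m , ℕ.≤-refl))

  NonMinimal-cut⁺ : ∀ {m} → NonMinimal A m → m ∈ T → NonMinimal (cut A T) m
  NonMinimal-cut⁺ {m} m-nonMin m∈T with predecessor A m m-nonMin
  ... | p , p<m , p∈ , greatest = p , p<m , from (∈-cut A T) (p∈ , closed)
    where
    closed : ∀ q → q ∈ block A m → Between m p q → q ∈ T
    closed q q∈ (inj₁ (m<q , q≤p)) = ⊥-elim (ℕ.<-asym m<q (ℕ.≤-<-trans q≤p p<m))
    closed q q∈ (inj₂ (p<q , q≤m)) with ℕ.m≤n⇒m<n∨m≡n q≤m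
    ... | inj₁ q<m = ⊥-elim (ℕ.<⇒≱ p<q (greatest q q∈ q<m))
    ... | inj₂ q≡m = subst (_∈ T) (sym (toℕ-injective q≡m)) m∈T

  nonMinimals-cut : nonMinimals (cut A T) ≡ T ∩ nonMinimals A
  nonMinimals-cut = ⊆-antisym ⊆∩ ∩⊆
    where
    ⊆∩ : nonMinimals (cut A T) ⊆ T ∩ nonMinimals A
    ⊆∩ m∈ with NonMinimal-cut⁻ (to (∈-nonMinimals (cut A T)) m∈)
    ... | m-nonMin , m∈T = x∈p∩q⁺ (m∈T , from (∈-nonMinimals A) m-nonMin)
    ∩⊆ : T ∩ nonMinimals A ⊆ nonMinimals (cut A T)
    ∩⊆ m∈ with x∈p∩q⁻ T (nonMinimals A) m∈
    ... | m∈T , m∈H = from (∈-nonMinimals (cut A T)) (NonMinimal-cut⁺ (to (∈-nonMinimals A) m∈H) m∈T)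

cut-refines : (A : SetPartition n) {T U : Subset n} → (∀ {m} → NonMinimal A m → m ∈ T → m ∈ U) →
  ∀ {i j} → j ∈ block (cut A T) i → j ∈ block (cut A U) i
cut-refines A {T} {U} T⇒U j∈ with to (∈-cut A T) j∈
... | j∈A , closed = from (∈-cut A U) (j∈A , λ m m∈ b → T⇒U (Between⇒NonMinimal A j∈A m∈ b) (closed m m∈ b))

cut-cong : (A : SetPartition n) {T U : Subset n} →
  (∀ {m} → NonMinimal A m → m ∈ T ⇔ m ∈ U) → cut A T ≡ cut A U
cut-cong A T⇔U = partition-ext (cut-refines A (to ∘ T⇔U)) (cut-refines A (from ∘ T⇔U))

cut-⊤ : (A : SetPartition n) → cut A S.⊤ ≡ A
cut-⊤ A = partition-ext (λ j∈ → proj₁ (to (∈-cut A S.⊤) j∈))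
                        (λ j∈ → from (∈-cut A S.⊤) (j∈ , λ _ _ _ → ∈⊤))

module _ (A : SetPartition n) (T : Subset n) {m : Fin n} (m∉T : m ∉ T) (m-nonMin : NonMinimal A m) where

  private
    X Y : SetPartition n
    X = cut A T
    Y = cut A (T ∪ ⁅ m ⁆)

    p : Fin n
    p = proj₁ (predecessor A m m-nonMin)
    p<m : p < m
    p<m = proj₁ (proj₂ (predecessor A m m-nonMin))
    p∈[m] : p ∈ block A m
    p∈[m] = proj₁ (proj₂ (proj₂ (predecessor A m m-nonMin)))
    greatest : ∀ q → q ∈ block A m → q < m → q ≤ p
    greatest = proj₂ (proj₂ (proj₂ (predecessor A m m-nonMin)))

    -- In X, P is the block ending just before m and Q the block starting at m; Y merges them.
    P Q : Subset n
    P = block X p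
    Q = block X m

    ≤p : ∀ {x} → x ∈ P → x ≤ p
    ≤p {x} x∈P with to (∈-cut A T) x∈P | x F.≤? p
    ... | _ | yes x≤p = x≤p
    ... | x∈[p] , closed | no x≰p with x F.<? m
    ...   | yes x<m = ⊥-elim (x≰p (greatest x (block-trans A p∈[m] x∈[p]) x<m))
    ...   | no  x≮m = ⊥-elim (m∉T (closed m (block-sym A p∈[m]) (inj₁ (p<m , ℕ.≮⇒≥ x≮m))))

    m≤ : ∀ {y} → y ∈ Q → m ≤ y
    m≤ {y} y∈Q with to (∈-cut A T) y∈Q | y F.<? m
    ... | _ , closed | yes y<m = ⊥-elim (m∉T (closed m (block-refl A m) (inj₂ (y<m , ℕ.≤-refl))))
    ... | _          | no  y≮m = ℕ.≮⇒≥ y≮m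

    P<Q : ∀ x y → x ∈ P → y ∈ Q → x < y
    P<Q x y x∈P y∈Q = ℕ.≤-<-trans (≤p x∈P) (ℕ.<-≤-trans p<m (m≤ y∈Q))

    X⊑Y : ∀ {i j} → j ∈ block X i → j ∈ block Y i
    X⊑Y = cut-refines A (λ _ q∈T → x∈p∪q⁺ (inj₁ q∈T))

    m∈Y[p] : m ∈ block Y p
    m∈Y[p] = from (∈-cut A (T ∪ ⁅ m ⁆)) (block-sym A p∈[m] , closed)
      where
      closed : ∀ q → q ∈ block A p → Between p m q → q ∈ T ∪ ⁅ m ⁆
      closed q q∈ (inj₁ (p<q , q≤m)) with ℕ.m≤n⇒m<n∨m≡n q≤m
      ... | inj₁ q<m = ⊥-elim (ℕ.<⇒≱ p<q (greatest q (block-trans A p∈[m] q∈) q<m))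
      ... | inj₂ q≡m = x∈p∪q⁺ (inj₂ (subst (_∈ ⁅ m ⁆) (sym (toℕ-injective q≡m)) (x∈⁅x⁆ m)))
      closed q q∈ (inj₂ (m<q , q≤p)) = ⊥-elim (ℕ.<-asym m<q (ℕ.≤-<-trans q≤p p<m))

    P×Q⊆Y : ∀ {i j} → i ∈ P → j ∈ Q → j ∈ block Y i
    P×Q⊆Y i∈P j∈Q = block-trans Y (X⊑Y (block-sym X i∈P)) (block-trans Y m∈Y[p] (X⊑Y j∈Q))

    straddling : ∀ {i j} → j ∈ block Y i → m ∈ block A i → i < m → m ≤ j → i ∈ P × j ∈ Q
    straddling {i} {j} j∈Y m∈ i<m m≤j with to (∈-cut A (T ∪ ⁅ m ⁆)) j∈Y
    ... | j∈A , closed = from (∈-cut A T) (i∈[p] , closedP) , from (∈-cut A T) (j∈[m] , closedQ)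
      where
      i∈[p] : i ∈ block A p
      i∈[p] = block-trans A (block-sym A p∈[m]) (block-sym A m∈)
      i≤p : i ≤ p
      i≤p = greatest i (block-sym A m∈) i<m
      j∈[m] : j ∈ block A m
      j∈[m] = block-trans A (block-sym A m∈) j∈A
      inT : ∀ {q} → q ≢ m → q ∈ T ∪ ⁅ m ⁆ → q ∈ T
      inT q≢m q∈ with x∈p∪q⁻ T ⁅ m ⁆ q∈
      ... | inj₁ q∈T = q∈T
      ... | inj₂ q∈m = ⊥-elim (q≢m (x∈⁅y⁆⇒x≡y m q∈m))
      closedP : ∀ q → q ∈ block A p → Between p i q → q ∈ T
      closedP q q∈ (inj₁ (p<q , q≤i)) = ⊥-elim (ℕ.<⇒≱ p<q (ℕ.≤-trans q≤i i≤p))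
      closedP q q∈ (inj₂ (i<q , q≤p)) =
        inT (λ { refl → ℕ.<⇒≱ p<m q≤p })
            (closed q (block-trans A (block-sym A i∈[p]) q∈)
                      (inj₁ (i<q , ℕ.≤-trans q≤p (ℕ.≤-trans (ℕ.<⇒≤ p<m) m≤j))))
      closedQ : ∀ q → q ∈ block A m → Between m j q → q ∈ T
      closedQ q q∈ (inj₁ (m<q , q≤j)) =
        inT (λ { refl → ℕ.<-irrefl refl m<q }) (closed q (block-trans A m∈ q∈) (inj₁ (ℕ.<-trans i<m m<q , q≤j)))
      closedQ q q∈ (inj₂ (j<q , q≤m)) = ⊥-elim (ℕ.<⇒≱ j<q (ℕ.≤-trans q≤m m≤j))

    Y-blocks : ∀ {i j} → j ∈ block Y i → j ∈ block X i ⊎ (i ∈ P × j ∈ Q) ⊎ (i ∈ Q × j ∈ P)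
    Y-blocks {i} {j} j∈Y with to (∈-cut A (T ∪ ⁅ m ⁆)) j∈Y | (m ∈? block A i) ×-dec between? i j m
    ... | j∈A , closed | no ¬m-between = inj₁ (from (∈-cut A T) (j∈A , closedT))
      where
      closedT : ∀ q → q ∈ block A i → Between i j q → q ∈ T
      closedT q q∈ b with x∈p∪q⁻ T ⁅ m ⁆ (closed q q∈ b)
      ... | inj₁ q∈T = q∈T
      ... | inj₂ q∈m with x∈⁅y⁆⇒x≡y m q∈m
      ...   | refl = ⊥-elim (¬m-between (q∈ , b))
    ... | _ | yes (m∈ , inj₁ (i<m , m≤j)) = inj₂ (inj₁ (straddling j∈Y m∈ i<m m≤j))
    ... | j∈A , _ | yes (m∈ , inj₂ (j<m , m≤i)) =
      inj₂ (inj₂ (swap (straddling (block-sym Y j∈Y) (block-trans A (block-sym A j∈A) m∈) j<m m≤i)))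

    block-Y-merged : ∀ {i} → i ∈ P ⊎ i ∈ Q → block Y i ≡ P ∪ Q
    block-Y-merged {i} i∈P∪Q =
      ⊆-antisym (λ j∈ → ⊆P∪Q (Y-blocks j∈) i∈P∪Q) (λ j∈ → P∪Q⊆ (x∈p∪q⁻ P Q j∈) i∈P∪Q)
      where
      ⊆P∪Q : ∀ {j} → j ∈ block X i ⊎ (i ∈ P × j ∈ Q) ⊎ (i ∈ Q × j ∈ P) → i ∈ P ⊎ i ∈ Q → j ∈ P ∪ Q
      ⊆P∪Q {j} (inj₁ j∈X) (inj₁ i∈P) = x∈p∪q⁺ (inj₁ (subst (j ∈_) (block-≡ X i∈P) j∈X))
      ⊆P∪Q {j} (inj₁ j∈X) (inj₂ i∈Q) = x∈p∪q⁺ (inj₂ (subst (j ∈_) (block-≡ X i∈Q) j∈X))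
      ⊆P∪Q (inj₂ (inj₁ (_ , j∈Q))) _ = x∈p∪q⁺ (inj₂ j∈Q)
      ⊆P∪Q (inj₂ (inj₂ (_ , j∈P))) _ = x∈p∪q⁺ (inj₁ j∈P)
      P∪Q⊆ : ∀ {j} → j ∈ P ⊎ j ∈ Q → i ∈ P ⊎ i ∈ Q → j ∈ block Y i
      P∪Q⊆ {j} (inj₁ j∈P) (inj₁ i∈P) = X⊑Y (subst (j ∈_) (sym (block-≡ X i∈P)) j∈P)
      P∪Q⊆ {j} (inj₂ j∈Q) (inj₂ i∈Q) = X⊑Y (subst (j ∈_) (sym (block-≡ X i∈Q)) j∈Q)
      P∪Q⊆ (inj₂ j∈Q) (inj₁ i∈P) = P×Q⊆Y i∈P j∈Q
      P∪Q⊆ (inj₁ j∈P) (inj₂ i∈Q) = block-sym Y (P×Q⊆Y j∈P i∈Q)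

    block-Y-kept : ∀ {i} → i ∉ P → i ∉ Q → block Y i ≡ block X i
    block-Y-kept {i} i∉P i∉Q = ⊆-antisym ⊆X X⊑Y
      where
      ⊆X : block Y i ⊆ block X i
      ⊆X j∈ with Y-blocks j∈
      ... | inj₁ j∈X = j∈X
      ... | inj₂ (inj₁ (i∈P , _)) = ⊥-elim (i∉P i∈P)
      ... | inj₂ (inj₂ (i∈Q , _)) = ⊥-elim (i∉Q i∈Q)

  cut-covers : Covers (cut A T) (cut A (T ∪ ⁅ m ⁆))
  cut-covers = P , Q , (p , refl) , (m , refl) , P<Q , λ S → mk⇔ (parts⁻ S) (parts⁺ S)
    where
    parts⁻ : ∀ S → S ∈parts Y → (S ∈parts X × S ≢ P × S ≢ Q) ⊎ S ≡ P ∪ Q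
    parts⁻ S (k , [k]≡S) with k ∈? P | k ∈? Q
    ... | yes k∈P | _       = inj₂ (trans (sym [k]≡S) (block-Y-merged (inj₁ k∈P)))
    ... | no  _   | yes k∈Q = inj₂ (trans (sym [k]≡S) (block-Y-merged (inj₂ k∈Q)))
    ... | no  k∉P | no  k∉Q =
      inj₁ ( (k , trans (sym (block-Y-kept k∉P k∉Q)) [k]≡S)
           , (λ S≡P → k∉P (subst (k ∈_) (trans [k]≡S S≡P) (block-refl Y k)))
           , (λ S≡Q → k∉Q (subst (k ∈_) (trans [k]≡S S≡Q) (block-refl Y k))))
    parts⁺ : ∀ S → (S ∈parts X × S ≢ P × S ≢ Q) ⊎ S ≡ P ∪ Q → S ∈parts Y
    parts⁺ S (inj₁ ((k , [k]≡S) , S≢P , S≢Q)) =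
      k , trans (block-Y-kept (λ k∈P → S≢P (trans (sym [k]≡S) (block-≡ X k∈P)))
                              (λ k∈Q → S≢Q (trans (sym [k]≡S) (block-≡ X k∈Q)))) [k]≡S
    parts⁺ S (inj₂ S≡P∪Q) = p , trans (block-Y-merged (inj₁ (block-refl X p))) (sym S≡P∪Q)

cut-∪⁅⁆-≡ : (A : SetPartition n) (T : Subset n) {m : Fin n} →
  m ∈ T ⊎ ¬ NonMinimal A m → cut A T ≡ cut A (T ∪ ⁅ m ⁆)
cut-∪⁅⁆-≡ A T {m} redundant =
  cut-cong A (λ q-nonMin → mk⇔ (λ q∈T → x∈p∪q⁺ (inj₁ q∈T)) (back q-nonMin))
  where
  back : ∀ {q} → NonMinimal A q → q ∈ T ∪ ⁅ m ⁆ → q ∈ T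
  back {q} q-nonMin q∈ with x∈p∪q⁻ T ⁅ m ⁆ q∈
  ... | inj₁ q∈T = q∈T
  ... | inj₂ q∈m with x∈⁅y⁆⇒x≡y m q∈m
  ...   | refl = [ (λ m∈T → m∈T) , (λ minimal → ⊥-elim (minimal q-nonMin)) ] redundant

cut-≤*-∪⁅⁆ : (A : SetPartition n) (T : Subset n) (m : Fin n) → cut A T ≤* cut A (T ∪ ⁅ m ⁆)
cut-≤*-∪⁅⁆ A T m = step (m ∈? T) (nonMinimal? A m)
  where
  step : Dec (m ∈ T) → Dec (NonMinimal A m) → cut A T ≤* cut A (T ∪ ⁅ m ⁆)
  step (no m∉T) (yes m-nonMin) = cut-covers A T m∉T m-nonMin ◅ ε
  step (yes m∈T) _             = subst (cut A T ≤*_) (cut-∪⁅⁆-≡ A T (inj₁ m∈T)) ε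
  step (no _)    (no minimal)  = subst (cut A T ≤*_) (cut-∪⁅⁆-≡ A T (inj₂ minimal)) ε

∪⁅⁆-⊆ : {p q : Subset n} {x : Fin n} → p ⊆ q → x ∈ q → p ∪ ⁅ x ⁆ ⊆ q
∪⁅⁆-⊆ {p = p} {x = x} p⊆q x∈q y∈ with x∈p∪q⁻ p ⁅ x ⁆ y∈
... | inj₁ y∈p = p⊆q y∈p
... | inj₂ y∈x = subst (_∈ _) (sym (x∈⁅y⁆⇒x≡y x y∈x)) x∈q

cut-mono : (A : SetPartition n) {T U : Subset n} → T ⊆ U → cut A T ≤* cut A U
cut-mono A {T} {U} T⊆U = go (L.allFin _) T⊆U (λ {m} _ _ → ∈-allFin m)
  where
  go : ∀ {T} ms → T ⊆ U → (∀ {m} → m ∈ U → m ∉ T → m ∈ₗ ms) → cut A T ≤* cut A U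
  go {T} [] T⊆U missing = subst (cut A T ≤*_) (cong (cut A) (⊆-antisym T⊆U U⊆T)) ε
    where
    U⊆T : U ⊆ T
    U⊆T {m} m∈U with m ∈? T
    ... | yes m∈T = m∈T
    ... | no  m∉T with missing m∈U m∉T
    ...   | ()
  go {T} (m ∷ ms) T⊆U missing with m ∈? U
  ... | no m∉U = go ms T⊆U missing′
    where
    missing′ : ∀ {q} → q ∈ U → q ∉ T → q ∈ₗ ms
    missing′ q∈U q∉T with missing q∈U q∉T
    ... | here refl = ⊥-elim (m∉U q∈U)
    ... | there q∈ms = q∈ms
  ... | yes m∈U = cut-≤*-∪⁅⁆ A T m ◅◅ go ms (∪⁅⁆-⊆ T⊆U m∈U) missing′
    where
    missing′ : ∀ {q} → q ∈ U → q ∉ T ∪ ⁅ m ⁆ → q ∈ₗ ms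
    missing′ {q} q∈U q∉ with missing q∈U (λ q∈T → q∉ (x∈p∪q⁺ (inj₁ q∈T)))
    ... | here refl = ⊥-elim (q∉ (x∈p∪q⁺ (inj₂ (x∈⁅x⁆ q))))
    ... | there q∈ms = q∈ms

cut-≤* : (A : SetPartition n) (T : Subset n) → cut A T ≤* A
cut-≤* A T = subst (cut A T ≤*_) (cut-⊤ A) (cut-mono A ⊆⊤)

nonMinimals-mono : {A B : SetPartition n} → A ≤* B → nonMinimals A ⊆ nonMinimals B
nonMinimals-mono {A = A} {B} A≤B m∈ with to (∈-nonMinimals A) m∈
... | p , p<m , p∈ = from (∈-nonMinimals B) (p , p<m , ≤*⇒refines A≤B p∈)

≤*⇔nonMinimals-⊆ : {A B C : SetPartition n} → B ≤* A → C ≤* A → B ≤* C ⇔ nonMinimals B ⊆ nonMinimals C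
≤*⇔nonMinimals-⊆ {A = A} {B} {C} B≤A C≤A = mk⇔ nonMinimals-mono
  (λ ⊆ → subst₂ _≤*_ (sym (≤*⇒≡cut B≤A)) (sym (≤*⇒≡cut C≤A)) (cut-mono A ⊆))

-- Counting blocks

length-filter-tabulate : {X : Set} {P : X → Set} (P? : Decidable P) (f : Fin n → X) →
  length (filter P? (L.tabulate f)) ≡ ∣ tabulate (λ i → does (P? (f i))) ∣
length-filter-tabulate {n = zero}  P? f = refl
length-filter-tabulate {n = suc n} P? f with P? (f F.zero)
... | yes _ = cong suc (length-filter-tabulate P? (λ i → f (F.suc i)))
... | no  _ = length-filter-tabulate P? (λ i → f (F.suc i))

map⁺-injectiveOn : {X Y : Set} {f : X → Y} {xs : List X} →
  (∀ {x y} → x ∈ₗ xs → y ∈ₗ xs → f x ≡ f y → x ≡ y) → Unique xs → Unique (map f xs)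
map⁺-injectiveOn {xs = []} _ [] = []
map⁺-injectiveOn {f = f} {x ∷ xs} inj (x∉xs ∷ unique) =
  All.tabulate fresh ∷ map⁺-injectiveOn (λ x∈ y∈ → inj (there x∈) (there y∈)) unique
  where
  fresh : ∀ {y} → y ∈ₗ map f xs → f x ≢ y
  fresh y∈ fx≡y with ∈-map⁻ f y∈
  ... | z , z∈ , refl = All.lookup x∉xs z∈ (inj (here refl) (there z∈) fx≡y)

module _ (A : SetPartition n) where

  private
    minimal? : Decidable (λ i → ¬ NonMinimal A i)
    minimal? i = ¬? (nonMinimal? A i)

    minimals : List (Fin n)
    minimals = filter minimal? (L.allFin n)

    block-injectiveOn-minimals : ∀ {i j} → ¬ NonMinimal A i → ¬ NonMinimal A j → block A i ≡ block A j → i ≡ j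
    block-injectiveOn-minimals {i} {j} i-min j-min [i]≡[j] with <-cmp i j
    ... | tri< i<j _ _ = ⊥-elim (j-min (i , i<j , subst (i ∈_) [i]≡[j] (block-refl A i)))
    ... | tri≈ _ i≡j _ = i≡j
    ... | tri> _ _ j<i = ⊥-elim (i-min (j , j<i , subst (j ∈_) (sym [i]≡[j]) (block-refl A j)))

    ∈-blocks-of-minimals : ∀ {S} → S ∈ₗ deduplicate _≟ˢ_ (toList (proj₁ A)) ⇔ S ∈ₗ map (block A) minimals
    ∈-blocks-of-minimals {S} = mk⇔ fw bw
      where
      fw : S ∈ₗ deduplicate _≟ˢ_ (toList (proj₁ A)) → S ∈ₗ map (block A) minimals
      fw S∈ with VecMembership.∈-toList⁻ (from (deduplicate-∈⇔ _≟ˢ_) S∈)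
      ... | S∈blocks with minimalInBlock A (VecAny.index S∈blocks)
      ...   | j , j∈ , j-min =
        subst (_∈ₗ map (block A) minimals) (trans (block-≡ A j∈) (sym (lookup-index S∈blocks)))
          (∈-map⁺ (block A) (∈-filter⁺ minimal? (∈-allFin j) j-min))
      bw : S ∈ₗ map (block A) minimals → S ∈ₗ deduplicate _≟ˢ_ (toList (proj₁ A))
      bw S∈ with ∈-map⁻ (block A) S∈
      ... | i , _ , refl =
        to (deduplicate-∈⇔ _≟ˢ_) (VecMembership.∈-toList⁺ (VecMembership.∈-lookup i (proj₁ A)))

  -- Each block is counted once, through its least element.
  ℓ≡∣minimals∣ : ℓ A ≡ length minimals
  ℓ≡∣minimals∣ = begin
    ℓ A
      ≡⟨ ↭-length (∼bag⇒↭ (unique∧set⇒bag (DecUnique.deduplicate-! _≟ˢ_ _) unique-blocks ∈-blocks-of-minimals)) ⟩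
    length (map (block A) minimals)
      ≡⟨ LP.length-map (block A) minimals ⟩
    length minimals
      ∎
    where
    open ≡-Reasoning
    unique-blocks : Unique (map (block A) minimals)
    unique-blocks = map⁺-injectiveOn
      (λ i∈ j∈ → block-injectiveOn-minimals (proj₂ (∈-filter⁻ minimal? {xs = L.allFin n} i∈))
                                            (proj₂ (∈-filter⁻ minimal? {xs = L.allFin n} j∈)))
      (Unique.filter⁺ minimal? (Unique.allFin⁺ n))

  ℓ≡n∸∣nonMinimals∣ : ℓ A ≡ n ∸ ∣ nonMinimals A ∣
  ℓ≡n∸∣nonMinimals∣ = begin
    ℓ A                          ≡⟨ ℓ≡∣minimals∣ ⟩
    length minimals              ≡⟨ length-filter-tabulate minimal? (λ i → i) ⟩
    ∣ subsetOf minimal? ∣        ≡⟨ cong ∣_∣ (VP.tabulate-∘ not (λ i → does (nonMinimal? A i))) ⟩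
    ∣ ∁ (nonMinimals A) ∣        ≡⟨ ∣∁p∣≡n∸∣p∣ (nonMinimals A) ⟩
    n ∸ ∣ nonMinimals A ∣        ∎
    where open ≡-Reasoning

  rk≡∣nonMinimals∣ : rk A ≡ ∣ nonMinimals A ∣
  rk≡∣nonMinimals∣ = trans (cong (n ∸_) ℓ≡n∸∣nonMinimals∣) (ℕ.m∸[m∸n]≡n (∣p∣≤n (nonMinimals A)))

p⊆q⇒p∩q≡p : {p q : Subset n} → p ⊆ q → p ∩ q ≡ p
p⊆q⇒p∩q≡p {p = p} {q} p⊆q = ⊆-antisym (λ x∈ → proj₁ (x∈p∩q⁻ p q x∈)) (λ x∈p → x∈p∩q⁺ (x∈p , p⊆q x∈p))

restrict : (H : Subset n) → Subset n → Subset ∣ H ∣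
restrict V.[]             V.[]       = V.[]
restrict (inside  V.∷ H) (b V.∷ T) = b V.∷ restrict H T
restrict (outside V.∷ H) (_ V.∷ T) = restrict H T

expand : (H : Subset n) → Subset ∣ H ∣ → Subset n
expand V.[]             V.[]       = V.[]
expand (inside  V.∷ H) (b V.∷ s) = b V.∷ expand H s
expand (outside V.∷ H) s          = outside V.∷ expand H s

restrict-expand : (H : Subset n) (s : Subset ∣ H ∣) → restrict H (expand H s) ≡ s
restrict-expand V.[]             V.[]       = refl
restrict-expand (inside  V.∷ H) (b V.∷ s) = cong (b V.∷_) (restrict-expand H s)
restrict-expand (outside V.∷ H) s          = restrict-expand H s

expand-restrict : (H : Subset n) {T : Subset n} → T ⊆ H → expand H (restrict H T) ≡ T
expand-restrict V.[]             {V.[]}           _   = refl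
expand-restrict (inside  V.∷ H) {b V.∷ T}       T⊆H = cong (b V.∷_) (expand-restrict H (drop-∷-⊆ T⊆H))
expand-restrict (outside V.∷ H) {outside V.∷ T} T⊆H = cong (outside V.∷_) (expand-restrict H (drop-∷-⊆ T⊆H))
expand-restrict (outside V.∷ H) {inside  V.∷ T} T⊆H with T⊆H V.here
... | ()

expand-⊆ : (H : Subset n) (s : Subset ∣ H ∣) → expand H s ⊆ H
expand-⊆ V.[]             V.[]       = λ ()
expand-⊆ (inside  V.∷ H) (inside  V.∷ s) = s⊆s (expand-⊆ H s)
expand-⊆ (inside  V.∷ H) (outside V.∷ s) = out⊆ (expand-⊆ H s)
expand-⊆ (outside V.∷ H) s               = out⊆ (expand-⊆ H s)

expand-mono : (H : Subset n) {s t : Subset ∣ H ∣} → s ⊆ t → expand H s ⊆ expand H t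
expand-mono V.[]             {V.[]}     {V.[]}     _   = λ ()
expand-mono (inside  V.∷ H) {outside V.∷ s} {_ V.∷ t} s⊆t = out⊆ (expand-mono H (drop-∷-⊆ s⊆t))
expand-mono (inside  V.∷ H) {inside  V.∷ s} {_ V.∷ t} s⊆t with s⊆t V.here
... | V.here = s⊆s (expand-mono H (drop-∷-⊆ s⊆t))
expand-mono (outside V.∷ H) s⊆t = out⊆ (expand-mono H s⊆t)

restrict-mono : (H : Subset n) {T U : Subset n} → T ⊆ U → restrict H T ⊆ restrict H U
restrict-mono V.[]             {V.[]}     {V.[]}     _   = λ ()
restrict-mono (inside  V.∷ H) {outside V.∷ T} {_ V.∷ U} T⊆U = out⊆ (restrict-mono H (drop-∷-⊆ T⊆U))
restrict-mono (inside  V.∷ H) {inside  V.∷ T} {_ V.∷ U} T⊆U with T⊆U V.here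
... | V.here = s⊆s (restrict-mono H (drop-∷-⊆ T⊆U))
restrict-mono (outside V.∷ H) {_ V.∷ T} {_ V.∷ U} T⊆U = restrict-mono H (drop-∷-⊆ T⊆U)

∣expand∣≡∣s∣ : (H : Subset n) (s : Subset ∣ H ∣) → ∣ expand H s ∣ ≡ ∣ s ∣
∣expand∣≡∣s∣ V.[]             V.[]            = refl
∣expand∣≡∣s∣ (inside  V.∷ H) (inside  V.∷ s) = cong suc (∣expand∣≡∣s∣ H s)
∣expand∣≡∣s∣ (inside  V.∷ H) (outside V.∷ s) = ∣expand∣≡∣s∣ H s
∣expand∣≡∣s∣ (outside V.∷ H) s               = ∣expand∣≡∣s∣ H s

restrict-self : (H : Subset n) → restrict H H ≡ S.⊤
restrict-self V.[]            = refl
restrict-self (inside  V.∷ H) = cong (inside V.∷_) (restrict-self H)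
restrict-self (outside V.∷ H) = restrict-self H

module DownSet (A : SetPartition n) where

  H : Subset n
  H = nonMinimals A

  k : ℕ
  k = ∣ H ∣

  encode : SetPartition n → Subset k
  encode B = restrict H (nonMinimals B)

  decode : Subset k → SetPartition n
  decode s = cut A (expand H s)

  decode-≤* : ∀ s → decode s ≤* A
  decode-≤* s = cut-≤* A (expand H s)

  nonMinimals-decode : ∀ s → nonMinimals (decode s) ≡ expand H s
  nonMinimals-decode s = trans (nonMinimals-cut A (expand H s)) (p⊆q⇒p∩q≡p (expand-⊆ H s))

  encode-decode : ∀ s → encode (decode s) ≡ s
  encode-decode s = trans (cong (restrict H) (nonMinimals-decode s)) (restrict-expand H s)

  decode-encode : ∀ {B} → B ≤* A → decode (encode B) ≡ B
  decode-encode B≤A = trans (cong (cut A) (expand-restrict H (nonMinimals-mono B≤A))) (sym (≤*⇒≡cut B≤A))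

  encode-⊆⇔ : ∀ {B C} → B ≤* A → C ≤* A → B ≤* C ⇔ encode B ⊆ encode C
  encode-⊆⇔ {B} {C} B≤A C≤A = mk⇔ encoded decoded
    where
    encoded : B ≤* C → encode B ⊆ encode C
    encoded B≤C = restrict-mono H (nonMinimals-mono B≤C)
    decoded : encode B ⊆ encode C → B ≤* C
    decoded B⊆C = from (≤*⇔nonMinimals-⊆ B≤A C≤A)
      (subst₂ _⊆_ (expand-restrict H (nonMinimals-mono B≤A)) (expand-restrict H (nonMinimals-mono C≤A))
        (expand-mono H B⊆C))

  downIsBoolean : PosetNotions.DownIsBoolean _≤*_ A
  downIsBoolean =
    k , (λ (B , _) → encode B) , (λ s → decode s , decode-≤* s) ,
    (λ (_ , B≤A) → decode-encode B≤A) , encode-decode ,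
    λ (_ , B≤A) (_ , C≤A) → encode-⊆⇔ B≤A C≤A

⊆∧≢⇒⊂ : {p q : Subset n} → p ⊆ q → p ≢ q → p ⊂ q
⊆∧≢⇒⊂ {p = p} {q} p⊆q p≢q with any? (λ x → (x ∈? q) ×-dec ¬? (x ∈? p))
... | yes (x , x∈q , x∉p) = p⊆q , x , x∈q , x∉p
... | no  none = ⊥-elim (p≢q (⊆-antisym p⊆q q⊆p))
  where
  q⊆p : q ⊆ p
  q⊆p {x} x∈q with x ∈? p
  ... | yes x∈p = x∈p
  ... | no  x∉p = ⊥-elim (none (x , x∈q , x∉p))

∣p∪⁅x⁆∣≡1+∣p∣ : {p : Subset n} {x : Fin n} → x ∉ p → ∣ p ∪ ⁅ x ⁆ ∣ ≡ suc ∣ p ∣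
∣p∪⁅x⁆∣≡1+∣p∣ {p = inside  V.∷ p} {F.zero}  x∉p = ⊥-elim (x∉p V.here)
∣p∪⁅x⁆∣≡1+∣p∣ {p = outside V.∷ p} {F.zero}  _   = cong suc (cong ∣_∣ (∪-identityʳ p))
∣p∪⁅x⁆∣≡1+∣p∣ {p = inside  V.∷ p} {F.suc x} x∉p = cong suc (∣p∪⁅x⁆∣≡1+∣p∣ (λ x∈p → x∉p (V.there x∈p)))
∣p∪⁅x⁆∣≡1+∣p∣ {p = outside V.∷ p} {F.suc x} x∉p = ∣p∪⁅x⁆∣≡1+∣p∣ (λ x∈p → x∉p (V.there x∈p))

nonMinimals-⊂ : {A B : SetPartition n} → A ≤* B → A ≢ B → nonMinimals A ⊂ nonMinimals B
nonMinimals-⊂ {A = A} {B} A≤B A≢B = ⊆∧≢⇒⊂ (nonMinimals-mono A≤B) (λ H≡H → A≢B (begin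
  A                          ≡⟨ ≤*⇒≡cut A≤B ⟩
  cut B (nonMinimals A)      ≡⟨ cong (cut B) H≡H ⟩
  cut B (nonMinimals B)      ≡⟨ ≤*⇒≡cut ε ⟨
  B                          ∎))
  where open ≡-Reasoning

module _ {n : ℕ} where
  open PosetNotions (_≤*_ {n})

  rk-minimal : (A : SetPartition n) → (∀ B → B ≤* A → B ≡ A) → rk A ≡ 0
  rk-minimal A minimal = begin
    rk A                             ≡⟨ rk≡∣nonMinimals∣ A ⟩
    ∣ nonMinimals A ∣                ≡⟨ cong (∣_∣ ∘ nonMinimals) (sym (minimal (cut A S.⊥) (cut-≤* A S.⊥))) ⟩
    ∣ nonMinimals (cut A S.⊥) ∣      ≡⟨ cong ∣_∣ (nonMinimals-cut A S.⊥) ⟩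
    ∣ S.⊥ ∩ nonMinimals A ∣          ≡⟨ cong ∣_∣ (∩-zeroˡ (nonMinimals A)) ⟩
    ∣ S.⊥ {n} ∣                      ≡⟨ ∣⊥∣≡0 n ⟩
    0                                ∎
    where open ≡-Reasoning

  -- Cutting B at the non-minimal elements of A and one more element m gives a partition
  -- strictly above A, hence B itself.
  rk-⋖ : (A B : SetPartition n) → A ⋖ B → rk B ≡ suc (rk A)
  rk-⋖ A B (A≤B , A≢B , nothing-between) with nonMinimals-⊂ A≤B A≢B
  ... | HA⊆HB , m , m∈HB , m∉HA = begin
    rk B                             ≡⟨ rk≡∣nonMinimals∣ B ⟩
    ∣ nonMinimals B ∣                ≡⟨ cong ∣_∣ HB≡T ⟩
    ∣ T ∣                            ≡⟨ ∣p∪⁅x⁆∣≡1+∣p∣ m∉HA ⟩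
    suc ∣ nonMinimals A ∣            ≡⟨ cong suc (rk≡∣nonMinimals∣ A) ⟨
    suc (rk A)                       ∎
    where
    open ≡-Reasoning
    T : Subset n
    T = nonMinimals A ∪ ⁅ m ⁆
    m∈Hcut : m ∈ nonMinimals (cut B T)
    m∈Hcut = subst (m ∈_) (sym (nonMinimals-cut B T)) (x∈p∩q⁺ (x∈p∪q⁺ (inj₂ (x∈⁅x⁆ m)) , m∈HB))
    A≤cut : A ≤* cut B T
    A≤cut = subst (_≤* cut B T) (sym (≤*⇒≡cut A≤B)) (cut-mono B (λ x∈ → x∈p∪q⁺ (inj₁ x∈)))
    cut≡B : cut B T ≡ B
    cut≡B with nothing-between (cut B T) A≤cut (cut-≤* B T)
    ... | inj₁ cut≡A = ⊥-elim (m∉HA (subst (λ C → m ∈ nonMinimals C) cut≡A m∈Hcut))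
    ... | inj₂ cut≡B = cut≡B
    HB≡T : nonMinimals B ≡ T
    HB≡T = begin
      nonMinimals B                  ≡⟨ cong nonMinimals cut≡B ⟨
      nonMinimals (cut B T)          ≡⟨ nonMinimals-cut B T ⟩
      T ∩ nonMinimals B              ≡⟨ p⊆q⇒p∩q≡p (∪⁅⁆-⊆ HA⊆HB m∈HB) ⟩
      T                              ∎

  rk-isRankFunction : IsRankFunction rk
  rk-isRankFunction = rk-minimal , rk-⋖

-- Möbius function

-- Definitionally equal to PosetNotions.sumℤ.
sum : List ℤ → ℤ
sum = L.foldr _+_ 0ℤ

sum-++ : (xs ys : List ℤ) → sum (xs L.++ ys) ≡ sum xs + sum ys
sum-++ []       ys = sym (ZP.+-identityˡ (sum ys))
sum-++ (x ∷ xs) ys = trans (cong (x +_) (sum-++ xs ys)) (sym (ZP.+-assoc x (sum xs) (sum ys)))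

sum-map-cong : {X : Set} {f g : X → ℤ} {xs : List X} →
  (∀ {x} → x ∈ₗ xs → f x ≡ g x) → sum (map f xs) ≡ sum (map g xs)
sum-map-cong {xs = []}     _  = refl
sum-map-cong {xs = x ∷ xs} eq = cong₂ _+_ (eq (here refl)) (sum-map-cong (λ x∈ → eq (there x∈)))

sum-map-neg : {X : Set} (f : X → ℤ) (xs : List X) → sum (map (λ x → - f x) xs) ≡ - sum (map f xs)
sum-map-neg f []       = refl
sum-map-neg f (x ∷ xs) = trans (cong (- f x +_) (sum-map-neg f xs)) (sym (ZP.neg-distrib-+ (f x) (sum (map f xs))))

sum-agreeAt : {X : Set} {f g : X → ℤ} {xs : List X} {c : X} → Unique xs → c ∈ₗ xs →
  (∀ {x} → x ∈ₗ xs → x ≢ c → f x ≡ g x) → sum (map f xs) ≡ sum (map g xs) → f c ≡ g c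
sum-agreeAt {f = f} {g} {x ∷ xs} (x∉xs ∷ unique) (here refl) agree sums≡ =
  ∙-cancelʳ (sum (map f xs)) (f x) (g x)
    (trans sums≡ (cong (g x +_) (sym (sum-map-cong (λ y∈ → agree (there y∈) (λ { refl → All.lookup x∉xs y∈ refl }))))))
sum-agreeAt {f = f} {g} {x ∷ xs} (x∉xs ∷ unique) (there c∈) agree sums≡ =
  sum-agreeAt unique c∈ (λ y∈ → agree (there y∈))
    (∙-cancelˡ (f x) _ _ (trans sums≡ (cong (_+ sum (map g xs)) (sym (agree (here refl) (All.lookup x∉xs c∈))))))

supersets : Subset n → List (Subset n)
supersets V.[]            = V.[] ∷ []
supersets (inside  V.∷ u) = map (inside V.∷_) (supersets u)
supersets (outside V.∷ u) = map (outside V.∷_) (supersets u) L.++ map (inside V.∷_) (supersets u)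

∈-supersets⁺ : {u s : Subset n} → u ⊆ s → s ∈ₗ supersets u
∈-supersets⁺ {u = V.[]}          {V.[]}          _   = here refl
∈-supersets⁺ {u = inside  V.∷ u} {inside  V.∷ s} u⊆s = ∈-map⁺ (inside V.∷_) (∈-supersets⁺ (drop-∷-⊆ u⊆s))
∈-supersets⁺ {u = inside  V.∷ u} {outside V.∷ s} u⊆s with u⊆s V.here
... | ()
∈-supersets⁺ {u = outside V.∷ u} {outside V.∷ s} u⊆s = ∈-++⁺ˡ (∈-map⁺ (outside V.∷_) (∈-supersets⁺ (drop-∷-⊆ u⊆s)))
∈-supersets⁺ {u = outside V.∷ u} {inside  V.∷ s} u⊆s =
  ∈-++⁺ʳ (map (outside V.∷_) (supersets u)) (∈-map⁺ (inside V.∷_) (∈-supersets⁺ (drop-∷-⊆ u⊆s)))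

∈-supersets⁻ : {u s : Subset n} → s ∈ₗ supersets u → u ⊆ s
∈-supersets⁻ {u = V.[]} {V.[]} _ = λ ()
∈-supersets⁻ {u = inside V.∷ u} s∈ with ∈-map⁻ (inside V.∷_) s∈
... | s′ , s′∈ , refl = s⊆s (∈-supersets⁻ s′∈)
∈-supersets⁻ {u = outside V.∷ u} s∈ with ∈-++⁻ (map (outside V.∷_) (supersets u)) s∈
... | inj₁ s∈₁ with ∈-map⁻ (outside V.∷_) s∈₁
...   | s′ , s′∈ , refl = out⊆ (∈-supersets⁻ s′∈)
∈-supersets⁻ {u = outside V.∷ u} s∈ | inj₂ s∈₂ with ∈-map⁻ (inside V.∷_) s∈₂
...   | s′ , s′∈ , refl = out⊆ (∈-supersets⁻ s′∈)

supersets-unique : (u : Subset n) → Unique (supersets u)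
supersets-unique V.[]            = All.[] ∷ []
supersets-unique (inside  V.∷ u) = Unique.map⁺ VP.∷-injectiveʳ (supersets-unique u)
supersets-unique (outside V.∷ u) =
  Unique.++⁺ (Unique.map⁺ VP.∷-injectiveʳ (supersets-unique u))
             (Unique.map⁺ VP.∷-injectiveʳ (supersets-unique u))
             disjoint
  where
  disjoint : ∀ {s} → ¬ (s ∈ₗ map (outside V.∷_) (supersets u) × s ∈ₗ map (inside V.∷_) (supersets u))
  disjoint (s∈₁ , s∈₂) with ∈-map⁻ (outside V.∷_) s∈₁ | ∈-map⁻ (inside V.∷_) s∈₂
  ... | _ , _ , refl | _ , _ , ()

sign : ℕ → ℤ
sign k = (- 1ℤ) ^ k

sign-suc : (k : ℕ) → sign (suc k) ≡ - sign k
sign-suc k = ZP.-1*i≡-i (sign k)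

-- Pairing each superset avoiding a missing element with the superset containing it cancels all terms.
alternatingSum-supersets : (u : Subset n) → u ≢ S.⊤ →
  sum (map (λ s → sign (∣ s ∣ ∸ ∣ u ∣)) (supersets u)) ≡ 0ℤ
alternatingSum-supersets V.[] u≢⊤ = ⊥-elim (u≢⊤ refl)
alternatingSum-supersets (inside V.∷ u) u≢⊤ =
  trans (cong sum (sym (LP.map-∘ (supersets u))))
        (alternatingSum-supersets u (λ u≡⊤ → u≢⊤ (cong (inside V.∷_) u≡⊤)))
alternatingSum-supersets (outside V.∷ u) _ = begin
  sum (map f (map (outside V.∷_) ss L.++ map (inside V.∷_) ss))
    ≡⟨ cong sum (LP.map-++ f (map (outside V.∷_) ss) (map (inside V.∷_) ss)) ⟩
  sum (map f (map (outside V.∷_) ss) L.++ map f (map (inside V.∷_) ss))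
    ≡⟨ sum-++ (map f (map (outside V.∷_) ss)) (map f (map (inside V.∷_) ss)) ⟩
  sum (map f (map (outside V.∷_) ss)) + sum (map f (map (inside V.∷_) ss))
    ≡⟨ cong₂ _+_ (cong sum (sym (LP.map-∘ ss))) (cong sum (sym (LP.map-∘ ss))) ⟩
  sum (map g ss) + sum (map (λ s → sign (suc ∣ s ∣ ∸ ∣ u ∣)) ss)
    ≡⟨ cong (sum (map g ss) +_) (trans (sum-map-cong flip-sign) (sum-map-neg g ss)) ⟩
  sum (map g ss) + - sum (map g ss)
    ≡⟨ ZP.+-inverseʳ (sum (map g ss)) ⟩
  0ℤ ∎
  where
  open ≡-Reasoning
  ss = supersets u
  f : Subset (suc _) → ℤ
  f s = sign (∣ s ∣ ∸ ∣ outside V.∷ u ∣)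
  g : Subset _ → ℤ
  g s = sign (∣ s ∣ ∸ ∣ u ∣)
  flip-sign : ∀ {s} → s ∈ₗ ss → sign (suc ∣ s ∣ ∸ ∣ u ∣) ≡ - g s
  flip-sign {s} s∈ =
    trans (cong sign (ℕ.+-∸-assoc 1 (p⊆q⇒∣p∣≤∣q∣ (∈-supersets⁻ {u = u} s∈)))) (sign-suc (∣ s ∣ ∸ ∣ u ∣))

[n∸a]∸[n∸b]≡b∸a : ∀ n {a b} → a ℕ.≤ b → b ℕ.≤ n → (n ∸ a) ∸ (n ∸ b) ≡ b ∸ a
[n∸a]∸[n∸b]≡b∸a n       ℕ.z≤n       b≤n         = ℕ.m∸[m∸n]≡n b≤n
[n∸a]∸[n∸b]≡b∸a (suc n) (ℕ.s≤s a≤b) (ℕ.s≤s b≤n) = [n∸a]∸[n∸b]≡b∸a n a≤b b≤n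

signℓ≡sign : {B C : SetPartition n} → B ≤* C → signℓ B C ≡ sign (∣ nonMinimals C ∣ ∸ ∣ nonMinimals B ∣)
signℓ≡sign {n = n} {B} {C} B≤C = cong sign (begin
  ℓ B ∸ ℓ C
    ≡⟨ cong₂ _∸_ (ℓ≡n∸∣nonMinimals∣ B) (ℓ≡n∸∣nonMinimals∣ C) ⟩
  (n ∸ ∣ nonMinimals B ∣) ∸ (n ∸ ∣ nonMinimals C ∣)
    ≡⟨ [n∸a]∸[n∸b]≡b∸a n (p⊆q⇒∣p∣≤∣q∣ (nonMinimals-mono B≤C)) (∣p∣≤n (nonMinimals C)) ⟩
  ∣ nonMinimals C ∣ ∸ ∣ nonMinimals B ∣
    ∎)
  where open ≡-Reasoning

module Interval (A : SetPartition n) where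
  open DownSet A public

  encode-self : encode A ≡ S.⊤
  encode-self = restrict-self H

  encode≡⊤⇒≡ : ∀ {B} → B ≤* A → encode B ≡ S.⊤ → B ≡ A
  encode≡⊤⇒≡ {B} B≤A u≡⊤ = begin
    B                     ≡⟨ decode-encode B≤A ⟨
    decode (encode B)     ≡⟨ cong decode (trans u≡⊤ (sym encode-self)) ⟩
    decode (encode A)     ≡⟨ decode-encode ε ⟩
    A                     ∎
    where open ≡-Reasoning

  ∣nonMinimals∣≡∣encode∣ : ∀ {B} → B ≤* A → ∣ nonMinimals B ∣ ≡ ∣ encode B ∣
  ∣nonMinimals∣≡∣encode∣ B≤A = trans (cong ∣_∣ (sym (expand-restrict H (nonMinimals-mono B≤A)))) (∣expand∣≡∣s∣ H _)

  interval : SetPartition n → List (SetPartition n)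
  interval B = map decode (supersets (encode B))

  interval-unique : ∀ B → Unique (interval B)
  interval-unique B = Unique.map⁺ decode-injective (supersets-unique (encode B))
    where
    decode-injective : ∀ {s t} → decode s ≡ decode t → s ≡ t
    decode-injective {s} {t} eq = trans (sym (encode-decode s)) (trans (cong encode eq) (encode-decode t))

  ∈-interval : ∀ {B} → B ≤* A → ∀ C → C ∈ₗ interval B ⇔ (B ≤* C × C ≤* A)
  ∈-interval {B} B≤A C = mk⇔ bounded enumerated
    where
    bounded : C ∈ₗ interval B → B ≤* C × C ≤* A
    bounded C∈ with ∈-map⁻ decode C∈
    ... | s , s∈ , refl =
      from (encode-⊆⇔ B≤A (decode-≤* s)) (subst (encode B ⊆_) (sym (encode-decode s)) (∈-supersets⁻ s∈)) ,
      decode-≤* s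
    enumerated : B ≤* C × C ≤* A → C ∈ₗ interval B
    enumerated (B≤C , C≤A) =
      subst (_∈ₗ interval B) (decode-encode C≤A) (∈-map⁺ decode (∈-supersets⁺ (to (encode-⊆⇔ B≤A C≤A) B≤C)))

  sum-signℓ-interval : ∀ {B} → B ≤* A → encode B ≢ S.⊤ → sum (map (signℓ B) (interval B)) ≡ 0ℤ
  sum-signℓ-interval {B} B≤A u≢⊤ = begin
    sum (map (signℓ B) (map decode ss))                ≡⟨ cong sum (LP.map-∘ ss) ⟨
    sum (map (λ s → signℓ B (decode s)) ss)            ≡⟨ sum-map-cong sign-decode ⟩
    sum (map (λ s → sign (∣ s ∣ ∸ ∣ encode B ∣)) ss)   ≡⟨ alternatingSum-supersets (encode B) u≢⊤ ⟩
    0ℤ                                                 ∎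
    where
    open ≡-Reasoning
    ss = supersets (encode B)
    ∣nonMinimals-decode∣ : ∀ s → ∣ nonMinimals (decode s) ∣ ≡ ∣ s ∣
    ∣nonMinimals-decode∣ s = trans (∣nonMinimals∣≡∣encode∣ (decode-≤* s)) (cong ∣_∣ (encode-decode s))
    sign-decode : ∀ {s} → s ∈ₗ ss → signℓ B (decode s) ≡ sign (∣ s ∣ ∸ ∣ encode B ∣)
    sign-decode {s} s∈ = trans (signℓ≡sign (proj₁ (to (∈-interval B≤A (decode s)) (∈-map⁺ decode s∈))))
                               (cong₂ (λ a b → sign (a ∸ b)) (∣nonMinimals-decode∣ s) (∣nonMinimals∣≡∣encode∣ B≤A))

module _ {n : ℕ} (μ : SetPartition n → SetPartition n → ℤ) (isMoebius : PosetNotions.IsMoebius _≤*_ μ)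
         (B : SetPartition n) where

  private
    _⊏_ : SetPartition n → SetPartition n → Set
    C′ ⊏ C = nonMinimals C′ ⊂ nonMinimals C

  -- Induction over the interval [B, C]: μ and signℓ B both sum to zero over it, and they
  -- agree on every element below C, so they also agree at C.
  μ≡signℓ : ∀ C → B ≤* C → μ B C ≡ signℓ B C
  μ≡signℓ C = go C (On.wellFounded nonMinimals ⊂-wellFounded C)
    where
    go : ∀ C → Acc _⊏_ C → B ≤* C → μ B C ≡ signℓ B C
    go C (acc smaller) B≤C = by-cases (encode B ≟ˢ S.⊤)
      where
      open Interval C
      by-cases : Dec (encode B ≡ S.⊤) → μ B C ≡ signℓ B C
      by-cases (yes u≡⊤) = subst (λ Z → μ B Z ≡ signℓ B Z) (encode≡⊤⇒≡ B≤C u≡⊤)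
        (trans (proj₁ isMoebius B) (cong sign (sym (ℕ.n∸n≡0 (ℓ B)))))
      by-cases (no u≢⊤) = sum-agreeAt (interval-unique B) (from (∈-interval B≤C C) (B≤C , ε)) agree
        (trans (proj₂ isMoebius B C B≤C B≢C (interval B) (interval-unique B) (∈-interval B≤C))
               (sym (sum-signℓ-interval B≤C u≢⊤)))
        where
        B≢C : B ≢ C
        B≢C refl = u≢⊤ encode-self
        agree : ∀ {Z} → Z ∈ₗ interval B → Z ≢ C → μ B Z ≡ signℓ B Z
        agree {Z} Z∈ Z≢C with to (∈-interval B≤C Z) Z∈
        ... | B≤Z , Z≤C = go Z (smaller (nonMinimals-⊂ Z≤C Z≢C)) B≤Z

mainTheorem6 : (n : ℕ) → n ≥ 1 →
    let open PosetNotions (_≤*_ {n}) in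
      IsRankFunction rk ×
      (∀ (μ : SetPartition n → SetPartition n → ℤ) → IsMoebius μ →
         ∀ B C → B ≤* C → μ B C ≡ signℓ B C) ×
      (∀ (A : SetPartition n) → DownIsBoolean A)
mainTheorem6 n _ = rk-isRankFunction , μ≡signℓ , DownSet.downIsBoolean
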